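{- For all sufficiently large $n$, there exist linear trifferent codes of length $n$ and size at least $\tfrac{1}{3}(9/5)^{n/4}$.
   Context: A linear trifferent code of length $n$ is a linear subspace $C\subseteq\mathbb{F}_3^n$ such that for any three distinct $x,y,z\in C$ there exists a coordinate $i$ with $\{x_i,y_i,z_i\}=\mathbb{F}_3$. -}

module Defs where

open import Data.Nat using (ℕ)
open import Data.Fin using (Fin; zero; suc)
open import Data.Vec using (Vec; zipWith; map; lookup)
open import Data.List using (List)
open import Data.List.Membership.Propositional using (_∈_)
open import Data.List.Relation.Unary.Unique.Propositional using (Unique)
open import Data.Product using (∃; _×_)
open import Data.Sum using (_⊎_)
open import Relation.Binary.PropositionalEquality using (_≡_; _≢_)

F₃ : Set
F₃ = Fin 3

infixl 6 _+₃_
infixl 7 _*₃_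

_+₃_ : F₃ → F₃ → F₃
zero +₃ b = b
suc zero +₃ zero = suc zero
suc zero +₃ suc zero = suc (suc zero)
suc zero +₃ suc (suc zero) = zero
suc (suc zero) +₃ zero = suc (suc zero)
suc (suc zero) +₃ suc zero = zero
suc (suc zero) +₃ suc (suc zero) = suc zero

_*₃_ : F₃ → F₃ → F₃
zero *₃ b = zero
suc zero *₃ b = b
suc (suc zero) *₃ zero = zero
suc (suc zero) *₃ suc zero = suc (suc zero)
suc (suc zero) *₃ suc (suc zero) = suc zero

Word : ℕ → Set
Word n = Vec F₃ n

_⊕_ : ∀ {n} → Word n → Word n → Word n
_⊕_ = zipWith _+₃_

_·_ : ∀ {n} → F₃ → Word n → Word n
a · x = map (a *₃_) x

-- A (finite) code C ⊆ F₃ⁿ is given by a duplicate-free list of its elements;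
-- its size is the length of that list.
record IsLinear {n : ℕ} (C : List (Word n)) : Set where
  field
    unique   : Unique C
    nonempty : ∃ λ x → x ∈ C
    closed+  : ∀ {x y} → x ∈ C → y ∈ C → (x ⊕ y) ∈ C
    closed·  : ∀ (a : F₃) {x} → x ∈ C → (a · x) ∈ C

IsTrifferent : ∀ {n} → List (Word n) → Set
IsTrifferent {n} C =
  ∀ {x y z} → x ∈ C → y ∈ C → z ∈ C → x ≢ y → y ≢ z → x ≢ z →
  ∃ λ (i : Fin n) → ∀ (a : F₃) →
    a ≡ lookup x i ⊎ a ≡ lookup y i ⊎ a ≡ lookup z i

-- A list gs of columns in F₃ᵏ encodes a message u as the word (u · g)_{g ∈ gs}.  The resulting
-- linear code is trifferent, and for k ≥ 2 has 3ᵏ codewords, as soon as the columns are separating: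
-- for every linearly independent pair (a, b) of messages some column g has {0, a · g, b · g} = F₃.
-- Indeed, writing three distinct codewords as x, x + α, x + β, the coordinate of such a column
-- covers F₃ when the message differences are independent, and otherwise β = 2α and any coordinate
-- with αᵢ ≠ 0 does.
--
-- Separating columns are found by a derandomised first-moment argument.  Columns come in blocks
-- m₁, m₂, m₁ + m₂, m₁ + 2m₂ (the tetracode) or single columns m₁.  For independent (a, b) the values
-- (a · m₁, b · m₁, a · m₂, b · m₂) are uniformly distributed over F₃⁴, so a tetracode block fails to
-- split the pair for 25 of the 81 values and a single column for 63.  Choosing the blocks one by one
-- so that the number of unsplit pairs is at most its average, and counting pairs only up to
-- (a, b) ↦ (2a, 2b), fewer than 9ᵏ / 2 · (25/81)ᴺ · (63/81)ʳ pairs remain, which is 0 when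
-- 9ᵏ · 25ᴺ · 63ʳ ≤ 2 · 81ᴺ⁺ʳ.  For n = 4N + r with r < 4, the largest such k gives (3 · 3ᵏ)⁴ · 5ⁿ ≥ 9ⁿ.

module Submission where

open import Defs
open import Data.Bool using (true; false; if_then_else_)
open import Data.Nat
  using (ℕ; zero; suc; _+_; _*_; _^_; _≤_; _<_; _≤′_; ≤′-refl; ≤′-step; z≤n; s≤s; NonZero; >-nonZero; _<?_; _/_; _%_)
open import Data.Nat.Properties
open import Data.Nat.DivMod using (m≡m%n+[m/n]*n; m%n<n; /-monoˡ-≤)
open import Data.Nat.ListAction using (sum; product)
open import Data.Nat.Tactic.RingSolver using (solve-∀)
open import Data.Fin using (Fin; zero; suc)
open import Data.Fin.Patterns using (0F; 1F; 2F)
open import Data.Fin.Properties using (all?; any?; ¬∀⟶∃¬) renaming (_≟_ to _≟₃_)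
open import Data.Vec using ([]; _∷_; lookup; replicate)
open import Data.Vec.Properties
  using (∷-injective; lookup-map; lookup-zipWith; lookup-replicate; tabulate∘lookup; tabulate-cong)
  renaming (≡-dec to ≡-decᵛ)
open import Data.List as List using (List; []; _∷_; _++_; length; allFin; cartesianProductWith)
open import Data.List.Properties using (length-++; length-map)
open import Data.List.Relation.Unary.Any as Any using (Any; here; there)
open import Data.List.Relation.Unary.All using ([]; _∷_)
open import Data.List.Relation.Unary.AllPairs using ([]; _∷_)
open import Data.List.Membership.Propositional using (_∈_)
open import Data.List.Membership.Propositional.Properties using (∈-map⁺; ∈-map⁻; ∈-allFin; ∈-cartesianProductWith⁺)
open import Data.List.Relation.Unary.Unique.Propositional using (Unique)
open import Data.List.Relation.Unary.Unique.Propositional.Properties as Unique using (allFin⁺)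
open import Data.List.Extrema.Nat using (argmin; f[argmin]≤f[⊤]; f[argmin]≤f[xs])
open import Data.Product using (∃; ∃₂; _×_; _,_; proj₁; proj₂)
open import Data.Sum as Sum using (_⊎_; inj₁; inj₂; [_,_]′)
open import Function using (_∘_)
open import Relation.Binary.PropositionalEquality
open import Relation.Nullary using (¬_; Dec; yes; no; does; ¬?; _→-dec_; contradiction)
open import Relation.Nullary.Decidable using (from-yes; map′; decidable-stable; _⊎-dec_; _×-dec_)
open import Algebra.Properties.CommutativeSemigroup *-commutativeSemigroup using (x∙yz≈y∙xz)

+₃-identityʳ : ∀ x → x +₃ 0F ≡ x
+₃-identityʳ = from-yes (all? λ x → x +₃ 0F ≟₃ x)

+₃-comm : ∀ x y → x +₃ y ≡ y +₃ x
+₃-comm = from-yes (all? λ x → all? λ y → x +₃ y ≟₃ y +₃ x)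

+₃-interchange : ∀ x y z w → (x +₃ y) +₃ (z +₃ w) ≡ (x +₃ z) +₃ (y +₃ w)
+₃-interchange = from-yes (all? λ x → all? λ y → all? λ z → all? λ w →
  (x +₃ y) +₃ (z +₃ w) ≟₃ (x +₃ z) +₃ (y +₃ w))

*₃-zeroʳ : ∀ x → x *₃ 0F ≡ 0F
*₃-zeroʳ = from-yes (all? λ x → x *₃ 0F ≟₃ 0F)

*₃-identityʳ : ∀ x → x *₃ 1F ≡ x
*₃-identityʳ = from-yes (all? λ x → x *₃ 1F ≟₃ x)

*₃-comm : ∀ x y → x *₃ y ≡ y *₃ x
*₃-comm = from-yes (all? λ x → all? λ y → x *₃ y ≟₃ y *₃ x)

*₃-distribˡ-+₃ : ∀ x y z → x *₃ (y +₃ z) ≡ x *₃ y +₃ x *₃ z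
*₃-distribˡ-+₃ = from-yes (all? λ x → all? λ y → all? λ z → x *₃ (y +₃ z) ≟₃ x *₃ y +₃ x *₃ z)

0ʷ : ∀ {n} → Word n
0ʷ {n} = replicate n 0F

infixl 6 _⊖_

_⊖_ : ∀ {n} → Word n → Word n → Word n
u ⊖ v = u ⊕ (2F · v)

⊕-⊖-cancel : ∀ {n} (u v : Word n) → u ⊕ (v ⊖ u) ≡ v
⊕-⊖-cancel [] [] = refl
⊕-⊖-cancel (x ∷ u) (y ∷ v) = cong₂ _∷_ (cancel x y) (⊕-⊖-cancel u v)
  where
  cancel : ∀ x y → x +₃ (y +₃ 2F *₃ x) ≡ y
  cancel = from-yes (all? λ x → all? λ y → x +₃ (y +₃ 2F *₃ x) ≟₃ y)

⊖-self : ∀ {n} (u : Word n) → u ⊖ u ≡ 0ʷ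
⊖-self [] = refl
⊖-self (x ∷ u) = cong₂ _∷_ (self x) (⊖-self u)
  where
  self : ∀ x → x +₃ 2F *₃ x ≡ 0F
  self = from-yes (all? λ x → x +₃ 2F *₃ x ≟₃ 0F)

⊖≡0ʷ⇒≡ : ∀ {n} (u v : Word n) → u ⊖ v ≡ 0ʷ → u ≡ v
⊖≡0ʷ⇒≡ [] [] _ = refl
⊖≡0ʷ⇒≡ (x ∷ u) (y ∷ v) eq =
  cong₂ _∷_ (difference x y (proj₁ (∷-injective eq))) (⊖≡0ʷ⇒≡ u v (proj₂ (∷-injective eq)))
  where
  difference : ∀ x y → x +₃ 2F *₃ y ≡ 0F → x ≡ y
  difference = from-yes (all? λ x → all? λ y → x +₃ 2F *₃ y ≟₃ 0F →-dec x ≟₃ y)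

⊖-injectiveˡ : ∀ {n} (u : Word n) {v w} → v ⊖ u ≡ w ⊖ u → v ≡ w
⊖-injectiveˡ u {v} {w} eq = trans (sym (⊕-⊖-cancel u v)) (trans (cong (u ⊕_) eq) (⊕-⊖-cancel u w))

·-identityˡ : ∀ {n} (u : Word n) → 1F · u ≡ u
·-identityˡ [] = refl
·-identityˡ (x ∷ u) = cong (x ∷_) (·-identityˡ u)

·-zeroˡ : ∀ {n} (u : Word n) → 0F · u ≡ 0ʷ
·-zeroˡ [] = refl
·-zeroˡ (x ∷ u) = cong (0F ∷_) (·-zeroˡ u)

dot : ∀ {n} → Word n → Word n → F₃
dot [] [] = 0F
dot (x ∷ u) (y ∷ v) = x *₃ y +₃ dot u v

dot-⊕ʳ : ∀ {n} (u v w : Word n) → dot u (v ⊕ w) ≡ dot u v +₃ dot u w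
dot-⊕ʳ [] [] [] = refl
dot-⊕ʳ (x ∷ u) (y ∷ v) (z ∷ w) =
  trans (cong₂ _+₃_ (*₃-distribˡ-+₃ x y z) (dot-⊕ʳ u v w))
        (+₃-interchange (x *₃ y) (x *₃ z) (dot u v) (dot u w))

dot-·ʳ : ∀ {n} c (u v : Word n) → dot u (c · v) ≡ c *₃ dot u v
dot-·ʳ c [] [] = sym (*₃-zeroʳ c)
dot-·ʳ c (x ∷ u) (y ∷ v) =
  trans (cong₂ _+₃_ (swap x c y) (dot-·ʳ c u v)) (sym (*₃-distribˡ-+₃ c (x *₃ y) (dot u v)))
  where
  swap : ∀ x c y → x *₃ (c *₃ y) ≡ c *₃ (x *₃ y)
  swap = from-yes (all? λ x → all? λ c → all? λ y → x *₃ (c *₃ y) ≟₃ c *₃ (x *₃ y))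

dot-comm : ∀ {n} (u v : Word n) → dot u v ≡ dot v u
dot-comm [] [] = refl
dot-comm (x ∷ u) (y ∷ v) = cong₂ _+₃_ (*₃-comm x y) (dot-comm u v)

dot-⊕ˡ : ∀ {n} (u v w : Word n) → dot (u ⊕ v) w ≡ dot u w +₃ dot v w
dot-⊕ˡ u v w = trans (dot-comm (u ⊕ v) w)
  (trans (dot-⊕ʳ w u v) (cong₂ _+₃_ (dot-comm w u) (dot-comm w v)))

dot-·ˡ : ∀ {n} c (u v : Word n) → dot (c · u) v ≡ c *₃ dot u v
dot-·ˡ c u v = trans (dot-comm (c · u) v) (trans (dot-·ʳ c v u) (cong (c *₃_) (dot-comm v u)))

dot-zeroʳ : ∀ {n} (u : Word n) → dot u 0ʷ ≡ 0F
dot-zeroʳ [] = refl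
dot-zeroʳ (x ∷ u) = cong₂ _+₃_ (*₃-zeroʳ x) (dot-zeroʳ u)

unit : ∀ {n} → Fin n → Word n
unit {suc n} zero = 1F ∷ 0ʷ
unit {suc n} (suc i) = 0F ∷ unit i

dot-unitʳ : ∀ {n} (u : Word n) i → dot u (unit i) ≡ lookup u i
dot-unitʳ (x ∷ u) zero = trans (cong (x *₃ 1F +₃_) (dot-zeroʳ u)) (trans (+₃-identityʳ _) (*₃-identityʳ x))
dot-unitʳ (x ∷ u) (suc i) = cong₂ _+₃_ (*₃-zeroʳ x) (dot-unitʳ u i)

lookup-extensionality : ∀ {n} (u v : Word n) → (∀ i → lookup u i ≡ lookup v i) → u ≡ v
lookup-extensionality u v eq =
  trans (sym (tabulate∘lookup u)) (trans (tabulate-cong eq) (tabulate∘lookup v))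

≢0ʷ⇒nonzero-coordinate : ∀ {n} (u : Word n) → u ≢ 0ʷ → ∃ λ i → lookup u i ≢ 0F
≢0ʷ⇒nonzero-coordinate {n} u u≢0 with all? (λ i → lookup u i ≟₃ 0F)
... | yes zeros = contradiction
      (lookup-extensionality u 0ʷ λ i → trans (zeros i) (sym (lookup-replicate i 0F))) u≢0
... | no ¬zeros = ¬∀⟶∃¬ n _ (λ i → lookup u i ≟₃ 0F) ¬zeros

-- Independent pairs of words

-- The determinant of the rows (p, q) and (r, s), with 2F playing the role of -1.
det₂ : F₃ → F₃ → F₃ → F₃ → F₃
det₂ p q r s = p *₃ s +₃ 2F *₃ (q *₃ r)

minor : ∀ {n} → Word n → Word n → Fin n → Fin n → F₃
minor a b i j = det₂ (lookup a i) (lookup b i) (lookup a j) (lookup b j)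

Independent : ∀ {n} → Word n → Word n → Set
Independent a b = ∃₂ λ i j → minor a b i j ≢ 0F

independent? : ∀ {n} (a b : Word n) → Dec (Independent a b)
independent? a b = any? λ i → any? λ j → ¬? (minor a b i j ≟₃ 0F)

-- Cramer's rule: a nonzero determinant over F₃ is its own inverse.
cramer : ∀ p q r s x y → det₂ p q r s ≢ 0F →
  let d = det₂ p q r s
      u = d *₃ (x *₃ s +₃ 2F *₃ (y *₃ r))
      v = d *₃ (y *₃ p +₃ 2F *₃ (x *₃ q))
  in u *₃ p +₃ v *₃ r ≡ x × u *₃ q +₃ v *₃ s ≡ y
cramer = from-yes (all? λ p → all? λ q → all? λ r → all? λ s → all? λ x → all? λ y →
  let d = det₂ p q r s
      u = d *₃ (x *₃ s +₃ 2F *₃ (y *₃ r))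
      v = d *₃ (y *₃ p +₃ 2F *₃ (x *₃ q))
  in ¬? (d ≟₃ 0F) →-dec ((u *₃ p +₃ v *₃ r ≟₃ x) ×-dec (u *₃ q +₃ v *₃ s ≟₃ y)))

independent⇒onto : ∀ {n} (a b : Word n) → Independent a b →
  ∀ x y → ∃ λ m → dot a m ≡ x × dot b m ≡ y
independent⇒onto a b (i , j , minor≢0) x y =
  (u · unit i) ⊕ (v · unit j) , combine a (proj₁ solved) , combine b (proj₂ solved)
  where
  d = minor a b i j
  u = d *₃ (x *₃ lookup b j +₃ 2F *₃ (y *₃ lookup a j))
  v = d *₃ (y *₃ lookup a i +₃ 2F *₃ (x *₃ lookup b i))
  solved = cramer (lookup a i) (lookup b i) (lookup a j) (lookup b j) x y minor≢0
  combine : ∀ c {z} → u *₃ lookup c i +₃ v *₃ lookup c j ≡ z → dot c ((u · unit i) ⊕ (v · unit j)) ≡ z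
  combine c eq = begin
    dot c ((u · unit i) ⊕ (v · unit j))          ≡⟨ dot-⊕ʳ c _ _ ⟩
    dot c (u · unit i) +₃ dot c (v · unit j)     ≡⟨ cong₂ _+₃_ (dot-·ʳ u c _) (dot-·ʳ v c _) ⟩
    u *₃ dot c (unit i) +₃ v *₃ dot c (unit j)   ≡⟨ cong₂ (λ p q → u *₃ p +₃ v *₃ q) (dot-unitʳ c i) (dot-unitʳ c j) ⟩
    u *₃ lookup c i +₃ v *₃ lookup c j           ≡⟨ eq ⟩
    _                                            ∎
    where open ≡-Reasoning

dependent⇒multiple : ∀ {n} (a b : Word n) → ¬ Independent a b → a ≢ 0ʷ → ∃ λ c → b ≡ c · a
dependent⇒multiple a b dependent a≢0 = multiple (≢0ʷ⇒nonzero-coordinate a a≢0)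
  where
  proportional : ∀ p q → p ≢ 0F → ∃ λ c → ∀ r s → det₂ p q r s ≡ 0F → s ≡ c *₃ r
  proportional = from-yes (all? λ p → all? λ q → ¬? (p ≟₃ 0F) →-dec any? λ c →
    all? λ r → all? λ s → det₂ p q r s ≟₃ 0F →-dec s ≟₃ c *₃ r)
  multiple : (∃ λ i → lookup a i ≢ 0F) → ∃ λ c → b ≡ c · a
  multiple (i , aᵢ≢0) = c , lookup-extensionality b (c · a) λ j →
    trans (bⱼ≡caⱼ _ _ (decidable-stable (minor a b i j ≟₃ 0F) λ minor≢0 → dependent (i , j , minor≢0)))
          (sym (lookup-map j (c *₃_) a))
    where
    c = proj₁ (proportional (lookup a i) (lookup b i) aᵢ≢0)
    bⱼ≡caⱼ = proj₂ (proportional (lookup a i) (lookup b i) aᵢ≢0)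

independent⇒≢0ʷ : ∀ {n} (a b : Word n) → Independent a b → a ≢ 0ʷ
independent⇒≢0ʷ a b (i , j , minor≢0) refl = minor≢0
  (trans (cong₂ (λ p r → det₂ p (lookup b i) r (lookup b j)) (lookup-replicate i 0F) (lookup-replicate j 0F))
         (det₂-zero-column (lookup b i) (lookup b j)))
  where
  det₂-zero-column : ∀ q s → det₂ 0F q 0F s ≡ 0F
  det₂-zero-column = from-yes (all? λ q → all? λ s → det₂ 0F q 0F s ≟₃ 0F)

independent-·2 : ∀ {n} (a b : Word n) → Independent a b → Independent (2F · a) (2F · b)
independent-·2 a b (i , j , minor≢0) = i , j , λ vanishes → minor≢0 (begin
  minor a b i j                               ≡⟨ sym (det₂-scale aᵢ bᵢ aⱼ bⱼ) ⟩
  det₂ (2F *₃ aᵢ) (2F *₃ bᵢ) (2F *₃ aⱼ) (2F *₃ bⱼ)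
    ≡⟨ sym (cong₂ (λ p q → det₂ p q (2F *₃ aⱼ) (2F *₃ bⱼ)) (lookup-map i _ a) (lookup-map i _ b)) ⟩
  det₂ (lookup (2F · a) i) (lookup (2F · b) i) (2F *₃ aⱼ) (2F *₃ bⱼ)
    ≡⟨ sym (cong₂ (det₂ (lookup (2F · a) i) (lookup (2F · b) i)) (lookup-map j _ a) (lookup-map j _ b)) ⟩
  minor (2F · a) (2F · b) i j                 ≡⟨ vanishes ⟩
  0F                                          ∎)
  where
  open ≡-Reasoning
  aᵢ = lookup a i
  bᵢ = lookup b i
  aⱼ = lookup a j
  bⱼ = lookup b j
  det₂-scale : ∀ p q r s → det₂ (2F *₃ p) (2F *₃ q) (2F *₃ r) (2F *₃ s) ≡ det₂ p q r s
  det₂-scale = from-yes (all? λ p → all? λ q → all? λ r → all? λ s →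
    det₂ (2F *₃ p) (2F *₃ q) (2F *₃ r) (2F *₃ s) ≟₃ det₂ p q r s)

det₂-unit : ∀ p r → det₂ p 0F r 1F ≡ p
det₂-unit = from-yes (all? λ p → all? λ r → det₂ p 0F r 1F ≟₃ p)

independent-partner : ∀ {n} → 2 ≤ n → (a : Word n) → a ≢ 0ʷ → ∃ λ b → Independent a b
independent-partner {suc zero} (s≤s ()) a a≢0
independent-partner {suc (suc n)} _ a a≢0 with ≢0ʷ⇒nonzero-coordinate a a≢0
... | zero , a₀≢0 = unit 1F , zero , 1F , λ vanishes →
  a₀≢0 (trans (sym (det₂-unit (lookup a 0F) (lookup a 1F))) vanishes)
... | suc i , aᵢ≢0 = unit 0F , suc i , zero , λ vanishes → aᵢ≢0 (begin
  lookup a (suc i)                 ≡⟨ sym (det₂-unit aᵢ₊₁ a₀) ⟩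
  det₂ aᵢ₊₁ 0F a₀ 1F               ≡⟨ cong (λ q → det₂ aᵢ₊₁ q a₀ 1F) (sym (lookup-replicate i 0F)) ⟩
  minor a (unit 0F) (suc i) zero   ≡⟨ vanishes ⟩
  0F                               ∎)
  where
  open ≡-Reasoning
  aᵢ₊₁ = lookup a (suc i)
  a₀ = lookup a 0F

-- Codes spanned by separating columns

Covers : F₃ → F₃ → F₃ → Set
Covers x y z = ∀ c → c ≡ x ⊎ c ≡ y ⊎ c ≡ z

covers? : ∀ x y z → Dec (Covers x y z)
covers? x y z = all? λ c → (c ≟₃ x) ⊎-dec (c ≟₃ y) ⊎-dec (c ≟₃ z)

Covers-translate : ∀ x α β → Covers 0F α β → Covers x (x +₃ α) (x +₃ β)
Covers-translate = from-yes (all? λ x → all? λ α → all? λ β →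
  covers? 0F α β →-dec covers? x (x +₃ α) (x +₃ β))

Covers⇒≢0 : ∀ α β → Covers 0F α β → α ≢ 0F
Covers⇒≢0 = from-yes (all? λ α → all? λ β → covers? 0F α β →-dec ¬? (α ≟₃ 0F))

Covers-·2⁻ : ∀ α β → Covers 0F (2F *₃ α) (2F *₃ β) → Covers 0F α β
Covers-·2⁻ = from-yes (all? λ α → all? λ β → covers? 0F (2F *₃ α) (2F *₃ β) →-dec covers? 0F α β)

Covers-multiple : ∀ α → α ≢ 0F → Covers 0F α (2F *₃ α)
Covers-multiple = from-yes (all? λ α → ¬? (α ≟₃ 0F) →-dec covers? 0F α (2F *₃ α))

covers-at-shift : ∀ {n} (x α β : Word n) → (∃ λ i → Covers 0F (lookup α i) (lookup β i)) →
  ∃ λ i → Covers (lookup x i) (lookup (x ⊕ α) i) (lookup (x ⊕ β) i)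
covers-at-shift x α β (i , covers) = i ,
  subst₂ (Covers (lookup x i)) (sym (lookup-zipWith _+₃_ i x α)) (sym (lookup-zipWith _+₃_ i x β))
    (Covers-translate (lookup x i) (lookup α i) (lookup β i) covers)

Splits : ∀ {k} → Word k → Word k → Word k → Set
Splits a b g = Covers 0F (dot a g) (dot b g)

splits? : ∀ {k} (a b g : Word k) → Dec (Splits a b g)
splits? a b g = covers? 0F (dot a g) (dot b g)

Splits-·2⁻ : ∀ {k} (a b : Word k) {g} → Splits (2F · a) (2F · b) g → Splits a b g
Splits-·2⁻ a b {g} splits =
  Covers-·2⁻ (dot a g) (dot b g) (subst₂ (Covers 0F) (dot-·ˡ 2F a g) (dot-·ˡ 2F b g) splits)

Separating : ∀ {k} → List (Word k) → Set
Separating {k} gs = ∀ (a b : Word k) → Independent a b → Any (Splits a b) gs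

encode : ∀ {k} (gs : List (Word k)) → Word k → Word (length gs)
encode [] u = []
encode (g ∷ gs) u = dot u g ∷ encode gs u

encode-⊕ : ∀ {k} (gs : List (Word k)) u v → encode gs (u ⊕ v) ≡ encode gs u ⊕ encode gs v
encode-⊕ [] u v = refl
encode-⊕ (g ∷ gs) u v = cong₂ _∷_ (dot-⊕ˡ u v g) (encode-⊕ gs u v)

encode-· : ∀ {k} (gs : List (Word k)) c u → encode gs (c · u) ≡ c · encode gs u
encode-· [] c u = refl
encode-· (g ∷ gs) c u = cong₂ _∷_ (dot-·ˡ c u g) (encode-· gs c u)

encode-⊖ : ∀ {k} (gs : List (Word k)) u v → encode gs (u ⊖ v) ≡ encode gs u ⊖ encode gs v
encode-⊖ gs u v = trans (encode-⊕ gs u (2F · v)) (cong (encode gs u ⊕_) (encode-· gs 2F v))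

splitting-coordinate : ∀ {k} (gs : List (Word k)) {a b} → Any (Splits a b) gs →
  ∃ λ i → Covers 0F (lookup (encode gs a) i) (lookup (encode gs b) i)
splitting-coordinate (g ∷ gs) (here splits) = zero , splits
splitting-coordinate (g ∷ gs) {a} {b} (there splits) with splitting-coordinate gs {a} {b} splits
... | i , covers = suc i , covers

allWords : ∀ k → List (Word k)
allWords zero = [] ∷ []
allWords (suc k) = cartesianProductWith _∷_ (allFin 3) (allWords k)

∈-allWords : ∀ {k} (u : Word k) → u ∈ allWords k
∈-allWords [] = here refl
∈-allWords (x ∷ u) = ∈-cartesianProductWith⁺ _∷_ (∈-allFin x) (∈-allWords u)

allWords-unique : ∀ k → Unique (allWords k)
allWords-unique zero = [] ∷ []
allWords-unique (suc k) = Unique.cartesianProductWith⁺ _∷_ ∷-injective (allFin⁺ 3) (allWords-unique k)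

length-allWords : ∀ k → length (allWords k) ≡ 3 ^ k
length-allWords zero = refl
length-allWords (suc k) = begin
  length (prefixed 0F ++ (prefixed 1F ++ (prefixed 2F ++ [])))
    ≡⟨ length-++ (prefixed 0F) ⟩
  length (prefixed 0F) + length (prefixed 1F ++ (prefixed 2F ++ []))
    ≡⟨ cong (length (prefixed 0F) +_) (length-++ (prefixed 1F)) ⟩
  length (prefixed 0F) + (length (prefixed 1F) + length (prefixed 2F ++ []))
    ≡⟨ cong (λ l → length (prefixed 0F) + (length (prefixed 1F) + l)) (length-++ (prefixed 2F)) ⟩
  length (prefixed 0F) + (length (prefixed 1F) + (length (prefixed 2F) + 0))
    ≡⟨ cong₂ _+_ (length-prefixed 0F) (cong₂ (λ l₁ l₂ → l₁ + (l₂ + 0)) (length-prefixed 1F) (length-prefixed 2F)) ⟩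
  3 ^ suc k ∎
  where
  open ≡-Reasoning
  prefixed : F₃ → List (Word (suc k))
  prefixed x = List.map (x ∷_) (allWords k)
  length-prefixed : ∀ x → length (prefixed x) ≡ 3 ^ k
  length-prefixed x = trans (length-map (x ∷_) (allWords k)) (length-allWords k)

codeOf : ∀ {k} (gs : List (Word k)) → List (Word (length gs))
codeOf {k} gs = List.map (encode gs) (allWords k)

length-codeOf : ∀ {k} (gs : List (Word k)) → length (codeOf gs) ≡ 3 ^ k
length-codeOf {k} gs = trans (length-map (encode gs) (allWords k)) (length-allWords k)

module SeparatingCode {k} (2≤k : 2 ≤ k) (gs : List (Word k)) (separating : Separating gs) where

  encode-≢0ʷ : ∀ {a} → a ≢ 0ʷ → ∃ λ i → lookup (encode gs a) i ≢ 0F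
  encode-≢0ʷ {a} a≢0 with independent-partner 2≤k a a≢0
  ... | b , independent with splitting-coordinate gs {a} {b} (separating a b independent)
  ... | i , splits = i , Covers⇒≢0 _ _ splits

  encode-injective : ∀ {u v} → encode gs u ≡ encode gs v → u ≡ v
  encode-injective {u} {v} eq with ≡-decᵛ _≟₃_ (u ⊖ v) 0ʷ
  ... | yes u⊖v≡0 = ⊖≡0ʷ⇒≡ u v u⊖v≡0
  ... | no u⊖v≢0 with encode-≢0ʷ u⊖v≢0
  ... | i , nonzero = contradiction (begin
    lookup (encode gs (u ⊖ v)) i              ≡⟨ cong (λ w → lookup w i) (encode-⊖ gs u v) ⟩
    lookup (encode gs u ⊖ encode gs v) i      ≡⟨ cong (λ w → lookup (w ⊖ encode gs v) i) eq ⟩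
    lookup (encode gs v ⊖ encode gs v) i      ≡⟨ cong (λ w → lookup w i) (⊖-self (encode gs v)) ⟩
    lookup 0ʷ i                               ≡⟨ lookup-replicate i 0F ⟩
    0F                                        ∎) nonzero
    where open ≡-Reasoning

  multiple-splits : ∀ {a} c → a ≢ 0ʷ → c · a ≢ 0ʷ → c · a ≢ a →
    ∃ λ i → Covers 0F (lookup (encode gs a) i) (lookup (encode gs (c · a)) i)
  multiple-splits 0F a≢0 ca≢0 ca≢a = contradiction (·-zeroˡ _) ca≢0
  multiple-splits 1F a≢0 ca≢0 ca≢a = contradiction (·-identityˡ _) ca≢a
  multiple-splits {a} 2F a≢0 ca≢0 ca≢a with encode-≢0ʷ a≢0
  ... | i , αᵢ≢0 = i , subst (Covers 0F αᵢ) (sym βᵢ≡2αᵢ) (Covers-multiple αᵢ αᵢ≢0)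
    where
    αᵢ = lookup (encode gs a) i
    βᵢ≡2αᵢ : lookup (encode gs (2F · a)) i ≡ 2F *₃ αᵢ
    βᵢ≡2αᵢ = trans (cong (λ w → lookup w i) (encode-· gs 2F a)) (lookup-map i _ (encode gs a))

  differences-split : ∀ {a b} → a ≢ 0ʷ → b ≢ 0ʷ → a ≢ b →
    ∃ λ i → Covers 0F (lookup (encode gs a) i) (lookup (encode gs b) i)
  differences-split {a} {b} a≢0 b≢0 a≢b with independent? a b
  ... | yes independent = splitting-coordinate gs {a} {b} (separating a b independent)
  ... | no dependent = dependent-split (dependent⇒multiple a b dependent a≢0)
    where
    dependent-split : (∃ λ c → b ≡ c · a) → ∃ λ i → Covers 0F (lookup (encode gs a) i) (lookup (encode gs b) i)
    dependent-split (c , refl) = multiple-splits c a≢0 b≢0 (λ eq → a≢b (sym eq))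

  triffers : ∀ p q r → encode gs p ≢ encode gs q → encode gs q ≢ encode gs r → encode gs p ≢ encode gs r →
    ∃ λ i → Covers (lookup (encode gs p) i) (lookup (encode gs q) i) (lookup (encode gs r) i)
  triffers p q r p≢q q≢r p≢r =
    subst₂ (λ y z → ∃ λ i → Covers (lookup (encode gs p) i) (lookup y i) (lookup z i))
      (shifted q) (shifted r)
      (covers-at-shift (encode gs p) (encode gs (q ⊖ p)) (encode gs (r ⊖ p))
        (differences-split (nonzero-difference p≢q) (nonzero-difference p≢r)
                           λ eq → q≢r (cong (encode gs) (⊖-injectiveˡ p eq))))
    where
    shifted : ∀ s → encode gs p ⊕ encode gs (s ⊖ p) ≡ encode gs s
    shifted s = trans (sym (encode-⊕ gs p (s ⊖ p))) (cong (encode gs) (⊕-⊖-cancel p s))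
    nonzero-difference : ∀ {s} → encode gs p ≢ encode gs s → s ⊖ p ≢ 0ʷ
    nonzero-difference {s} p≢s s⊖p≡0 = p≢s (cong (encode gs) (sym (⊖≡0ʷ⇒≡ s p s⊖p≡0)))

  codeOf-linear : IsLinear (codeOf gs)
  codeOf-linear = record
    { unique = Unique.map⁺ encode-injective (allWords-unique k)
    ; nonempty = encode gs 0ʷ , ∈-encode 0ʷ
    ; closed+ = closed+
    ; closed· = closed·
    }
    where
    ∈-encode : ∀ u → encode gs u ∈ codeOf gs
    ∈-encode u = ∈-map⁺ (encode gs) (∈-allWords u)
    closed+ : ∀ {x y} → x ∈ codeOf gs → y ∈ codeOf gs → (x ⊕ y) ∈ codeOf gs
    closed+ x∈ y∈ with ∈-map⁻ (encode gs) x∈ | ∈-map⁻ (encode gs) y∈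
    ... | u , _ , refl | v , _ , refl = subst (_∈ codeOf gs) (encode-⊕ gs u v) (∈-encode (u ⊕ v))
    closed· : ∀ c {x} → x ∈ codeOf gs → (c · x) ∈ codeOf gs
    closed· c x∈ with ∈-map⁻ (encode gs) x∈
    ... | u , _ , refl = subst (_∈ codeOf gs) (encode-· gs c u) (∈-encode (c · u))

  codeOf-trifferent : IsTrifferent (codeOf gs)
  codeOf-trifferent x∈ y∈ z∈ x≢y y≢z x≢z
    with ∈-map⁻ (encode gs) x∈ | ∈-map⁻ (encode gs) y∈ | ∈-map⁻ (encode gs) z∈
  ... | p , _ , refl | q , _ , refl | r , _ , refl = triffers p q r x≢y y≢z x≢z

∑₃ : (F₃ → ℕ) → ℕ
∑₃ f = f 0F + f 1F + f 2F

∑ : ∀ k → (Word k → ℕ) → ℕ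
∑ zero f = f []
∑ (suc k) f = ∑₃ λ x → ∑ k λ v → f (x ∷ v)

∑₃-cong : ∀ {f g : F₃ → ℕ} → (∀ x → f x ≡ g x) → ∑₃ f ≡ ∑₃ g
∑₃-cong eq = cong₂ _+_ (cong₂ _+_ (eq 0F) (eq 1F)) (eq 2F)

∑₃-mono-≤ : ∀ {f g : F₃ → ℕ} → (∀ x → f x ≤ g x) → ∑₃ f ≤ ∑₃ g
∑₃-mono-≤ le = +-mono-≤ (+-mono-≤ (le 0F) (le 1F)) (le 2F)

∑₃-+ : ∀ (f g : F₃ → ℕ) → ∑₃ (λ x → f x + g x) ≡ ∑₃ f + ∑₃ g
∑₃-+ f g = regroup (f 0F) (g 0F) (f 1F) (g 1F) (f 2F) (g 2F)
  where
  regroup : ∀ a b c d e h → (a + b) + (c + d) + (e + h) ≡ (a + c + e) + (b + d + h)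
  regroup = solve-∀

∑₃-*ˡ : ∀ c (f : F₃ → ℕ) → ∑₃ (λ x → c * f x) ≡ c * ∑₃ f
∑₃-*ˡ c f = factor c (f 0F) (f 1F) (f 2F)
  where
  factor : ∀ c a b d → c * a + c * b + c * d ≡ c * (a + b + d)
  factor = solve-∀

∑₃-const : ∀ c → ∑₃ (λ _ → c) ≡ 3 * c
∑₃-const c = triple c
  where
  triple : ∀ c → c + c + c ≡ 3 * c
  triple = solve-∀

∑₃-translate : ∀ c (f : F₃ → ℕ) → ∑₃ (λ x → f (x +₃ c)) ≡ ∑₃ f
∑₃-translate 0F f = ∑₃-cong λ x → cong f (+₃-identityʳ x)
∑₃-translate 1F f = rotate (f 1F) (f 2F) (f 0F)
  where
  rotate : ∀ a b c → a + b + c ≡ c + a + b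
  rotate = solve-∀
∑₃-translate 2F f = rotate (f 2F) (f 0F) (f 1F)
  where
  rotate : ∀ a b c → a + b + c ≡ b + c + a
  rotate = solve-∀

∑₃≡0 : ∀ (f : F₃ → ℕ) → ∑₃ f ≡ 0 → ∀ x → f x ≡ 0
∑₃≡0 f eq 0F = m+n≡0⇒m≡0 _ (m+n≡0⇒m≡0 _ eq)
∑₃≡0 f eq 1F = m+n≡0⇒n≡0 (f 0F) (m+n≡0⇒m≡0 _ eq)
∑₃≡0 f eq 2F = m+n≡0⇒n≡0 (f 0F + f 1F) eq

∑₃-argmin : ∀ (f : F₃ → ℕ) → ∃ λ x → 3 * f x ≤ ∑₃ f
∑₃-argmin f = x , subst (_≤ ∑₃ f) (∑₃-const (f x)) (∑₃-mono-≤ minimal)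
  where
  x = argmin f 0F (1F ∷ 2F ∷ [])
  minimal : ∀ y → f x ≤ f y
  minimal 0F = f[argmin]≤f[⊤] {f = f} 0F (1F ∷ 2F ∷ [])
  minimal 1F with f[argmin]≤f[xs] {f = f} 0F (1F ∷ 2F ∷ [])
  ... | x≤1 ∷ _ = x≤1
  minimal 2F with f[argmin]≤f[xs] {f = f} 0F (1F ∷ 2F ∷ [])
  ... | _ ∷ x≤2 ∷ _ = x≤2

∑-cong : ∀ k {f g : Word k → ℕ} → (∀ v → f v ≡ g v) → ∑ k f ≡ ∑ k g
∑-cong zero eq = eq []
∑-cong (suc k) eq = ∑₃-cong λ x → ∑-cong k λ v → eq (x ∷ v)

∑-mono-≤ : ∀ k {f g : Word k → ℕ} → (∀ v → f v ≤ g v) → ∑ k f ≤ ∑ k g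
∑-mono-≤ zero le = le []
∑-mono-≤ (suc k) le = ∑₃-mono-≤ λ x → ∑-mono-≤ k λ v → le (x ∷ v)

∑-+ : ∀ k (f g : Word k → ℕ) → ∑ k (λ v → f v + g v) ≡ ∑ k f + ∑ k g
∑-+ zero f g = refl
∑-+ (suc k) f g = trans (∑₃-cong λ x → ∑-+ k (λ v → f (x ∷ v)) (λ v → g (x ∷ v)))
  (∑₃-+ (λ x → ∑ k λ v → f (x ∷ v)) (λ x → ∑ k λ v → g (x ∷ v)))

∑-*ˡ : ∀ k c (f : Word k → ℕ) → ∑ k (λ v → c * f v) ≡ c * ∑ k f
∑-*ˡ zero c f = refl
∑-*ˡ (suc k) c f = trans (∑₃-cong λ x → ∑-*ˡ k c λ v → f (x ∷ v)) (∑₃-*ˡ c λ x → ∑ k λ v → f (x ∷ v))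

∑-const : ∀ k c → ∑ k (λ _ → c) ≡ 3 ^ k * c
∑-const zero c = sym (*-identityˡ c)
∑-const (suc k) c = trans (∑₃-cong λ _ → ∑-const k c) (trans (∑₃-const (3 ^ k * c)) (sym (*-assoc 3 (3 ^ k) c)))

∑-translate : ∀ k (w : Word k) (f : Word k → ℕ) → ∑ k (λ v → f (v ⊕ w)) ≡ ∑ k f
∑-translate zero [] f = refl
∑-translate (suc k) (c ∷ w) f =
  trans (∑₃-cong λ x → ∑-translate k w λ v → f ((x +₃ c) ∷ v)) (∑₃-translate c λ x → ∑ k λ v → f (x ∷ v))

∑≡0 : ∀ k (f : Word k → ℕ) → ∑ k f ≡ 0 → ∀ v → f v ≡ 0
∑≡0 zero f eq [] = eq
∑≡0 (suc k) f eq (x ∷ v) = ∑≡0 k (λ v → f (x ∷ v)) (∑₃≡0 (λ x → ∑ k λ v → f (x ∷ v)) eq x) v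

∑-argmin : ∀ k (f : Word k → ℕ) → ∃ λ v → 3 ^ k * f v ≤ ∑ k f
∑-argmin zero f = [] , ≤-reflexive (*-identityˡ (f []))
∑-argmin (suc k) f = minimiser (∑₃-argmin (λ x → ∑ k λ v → f (x ∷ v)))
  where
  minimiser : (∃ λ x → 3 * ∑ k (λ v → f (x ∷ v)) ≤ ∑ (suc k) f) → ∃ λ v → 3 ^ suc k * f v ≤ ∑ (suc k) f
  minimiser (x , x-minimal) with ∑-argmin k (λ v → f (x ∷ v))
  ... | v , v-minimal = x ∷ v ,
    ≤-trans (≤-reflexive (*-assoc 3 (3 ^ k) (f (x ∷ v)))) (≤-trans (*-monoʳ-≤ 3 v-minimal) x-minimal)

∑-∑₃-comm : ∀ k (f : Word k → F₃ → ℕ) → ∑ k (λ v → ∑₃ (f v)) ≡ ∑₃ (λ x → ∑ k (λ v → f v x))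
∑-∑₃-comm k f = trans (∑-+ k (λ v → f v 0F + f v 1F) (λ v → f v 2F))
  (cong (_+ ∑ k (λ v → f v 2F)) (∑-+ k (λ v → f v 0F) (λ v → f v 1F)))

∑-comm : ∀ k m (f : Word k → Word m → ℕ) → ∑ k (λ u → ∑ m (f u)) ≡ ∑ m (λ v → ∑ k (λ u → f u v))
∑-comm zero m f = refl
∑-comm (suc k) m f =
  trans (∑₃-cong λ x → ∑-comm k m λ u → f (x ∷ u)) (sym (∑-∑₃-comm m λ v x → ∑ k λ u → f (x ∷ u) v))

∑² : ∀ k → (Word k → Word k → ℕ) → ℕ
∑² k f = ∑ k λ u → ∑ k λ v → f u v

∑²-cong : ∀ k {f g : Word k → Word k → ℕ} → (∀ u v → f u v ≡ g u v) → ∑² k f ≡ ∑² k g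
∑²-cong k eq = ∑-cong k λ u → ∑-cong k (eq u)

∑²-*ˡ : ∀ k c (f : Word k → Word k → ℕ) → ∑² k (λ u v → c * f u v) ≡ c * ∑² k f
∑²-*ˡ k c f = trans (∑-cong k λ u → ∑-*ˡ k c (f u)) (∑-*ˡ k c λ u → ∑ k (f u))

∑²-comm : ∀ k (f : Word k → Word k → Word k → Word k → ℕ) →
  ∑² k (λ m₁ m₂ → ∑² k (f m₁ m₂)) ≡ ∑² k (λ a b → ∑² k (λ m₁ m₂ → f m₁ m₂ a b))
∑²-comm k f = begin
  ∑ k (λ m₁ → ∑ k λ m₂ → ∑ k λ a → ∑ k λ b → f m₁ m₂ a b)
    ≡⟨ ∑-cong k (λ m₁ → ∑-comm k k λ m₂ a → ∑ k λ b → f m₁ m₂ a b) ⟩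
  ∑ k (λ m₁ → ∑ k λ a → ∑ k λ m₂ → ∑ k λ b → f m₁ m₂ a b)
    ≡⟨ ∑-cong k (λ m₁ → ∑-cong k λ a → ∑-comm k k λ m₂ b → f m₁ m₂ a b) ⟩
  ∑ k (λ m₁ → ∑ k λ a → ∑ k λ b → ∑ k λ m₂ → f m₁ m₂ a b)
    ≡⟨ ∑-comm k k (λ m₁ a → ∑ k λ b → ∑ k λ m₂ → f m₁ m₂ a b) ⟩
  ∑ k (λ a → ∑ k λ m₁ → ∑ k λ b → ∑ k λ m₂ → f m₁ m₂ a b)
    ≡⟨ ∑-cong k (λ a → ∑-comm k k λ m₁ b → ∑ k λ m₂ → f m₁ m₂ a b) ⟩
  ∑ k (λ a → ∑ k λ b → ∑ k λ m₁ → ∑ k λ m₂ → f m₁ m₂ a b) ∎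
  where open ≡-Reasoning

∑²-argmin : ∀ k (f : Word k → Word k → ℕ) → ∃₂ λ u v → 3 ^ k * 3 ^ k * f u v ≤ ∑² k f
∑²-argmin k f with ∑-argmin k (λ u → ∑ k (f u))
... | u , u-minimal with ∑-argmin k (f u)
... | v , v-minimal = u , v ,
  ≤-trans (≤-reflexive (*-assoc (3 ^ k) (3 ^ k) (f u v))) (≤-trans (*-monoʳ-≤ (3 ^ k) v-minimal) u-minimal)

-- Equidistribution of (a · m, b · m) for independent a, b

∑₃² : (F₃ → F₃ → ℕ) → ℕ
∑₃² h = ∑₃ λ x → ∑₃ λ y → h x y

∑₃⁴ : (F₃ → F₃ → F₃ → F₃ → ℕ) → ℕ
∑₃⁴ h = ∑₃² λ x y → ∑₃² (h x y)

-- Translation by a solution w of (a · w, b · w) = (x, y) permutes the fibres of m ↦ (a · m, b · m),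
-- so all nine fibres have the same size.
∑-fibres : ∀ {k} (a b : Word k) → Independent a b → (h : F₃ → F₃ → ℕ) →
  9 * ∑ k (λ m → h (dot a m) (dot b m)) ≡ 3 ^ k * ∑₃² h
∑-fibres {k} a b independent h = begin
  9 * S                                                     ≡⟨ *-assoc 3 3 S ⟩
  3 * (3 * S)                                               ≡⟨ sym (trans (∑₃-cong λ _ → ∑₃-const S) (∑₃-const (3 * S))) ⟩
  ∑₃² (λ _ _ → S)                                           ≡⟨ ∑₃-cong (λ x → ∑₃-cong λ y → shifted x y) ⟩
  ∑₃² (λ x y → ∑ k λ m → h (x +₃ dot a m) (y +₃ dot b m))
    ≡⟨ ∑₃-cong (λ x → sym (∑-∑₃-comm k λ m y → h (x +₃ dot a m) (y +₃ dot b m))) ⟩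
  ∑₃ (λ x → ∑ k λ m → ∑₃ λ y → h (x +₃ dot a m) (y +₃ dot b m))
    ≡⟨ sym (∑-∑₃-comm k λ m x → ∑₃ λ y → h (x +₃ dot a m) (y +₃ dot b m)) ⟩
  ∑ k (λ m → ∑₃² λ x y → h (x +₃ dot a m) (y +₃ dot b m))   ≡⟨ ∑-cong k translated ⟩
  ∑ k (λ _ → ∑₃² h)                                          ≡⟨ ∑-const k (∑₃² h) ⟩
  3 ^ k * ∑₃² h                                              ∎
  where
  open ≡-Reasoning
  S = ∑ k λ m → h (dot a m) (dot b m)
  shifted : ∀ x y → S ≡ ∑ k λ m → h (x +₃ dot a m) (y +₃ dot b m)
  shifted x y = shift-by (independent⇒onto a b independent x y)
    where
    shift-by : (∃ λ w → dot a w ≡ x × dot b w ≡ y) → S ≡ ∑ k λ m → h (x +₃ dot a m) (y +₃ dot b m)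
    shift-by (w , aw≡x , bw≡y) = trans (sym (∑-translate k w λ m → h (dot a m) (dot b m)))
      (∑-cong k λ m → cong₂ h (shift a aw≡x m) (shift b bw≡y m))
      where
      shift : ∀ c {z} → dot c w ≡ z → ∀ m → dot c (m ⊕ w) ≡ z +₃ dot c m
      shift c cw≡z m = trans (dot-⊕ʳ c m w) (trans (cong (dot c m +₃_) cw≡z) (+₃-comm (dot c m) _))
  translated : ∀ m → ∑₃² (λ x y → h (x +₃ dot a m) (y +₃ dot b m)) ≡ ∑₃² h
  translated m = trans (∑₃-cong λ x → ∑₃-translate (dot b m) λ y → h (x +₃ dot a m) y)
                       (∑₃-translate (dot a m) λ x → ∑₃ (h x))

∑-blocks : ∀ {k} (a b : Word k) → Independent a b → (h : F₃ → F₃ → F₃ → F₃ → ℕ) →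
  81 * ∑² k (λ m₁ m₂ → h (dot a m₁) (dot b m₁) (dot a m₂) (dot b m₂)) ≡ 3 ^ k * 3 ^ k * ∑₃⁴ h
∑-blocks {k} a b independent h = begin
  81 * ∑² k H                          ≡⟨ *-assoc 9 9 (∑² k H) ⟩
  9 * (9 * ∑² k H)                     ≡⟨ cong (9 *_) (sym (∑-*ˡ k 9 λ m₁ → ∑ k (H m₁))) ⟩
  9 * ∑ k (λ m₁ → 9 * ∑ k (H m₁))      ≡⟨ cong (9 *_) (∑-cong k λ m₁ → ∑-fibres a b independent (G m₁)) ⟩
  9 * ∑ k (λ m₁ → 3 ^ k * ∑₃² (G m₁))  ≡⟨ cong (9 *_) (∑-*ˡ k (3 ^ k) λ m₁ → ∑₃² (G m₁)) ⟩
  9 * (3 ^ k * ∑ k (λ m₁ → ∑₃² (G m₁))) ≡⟨ x∙yz≈y∙xz 9 (3 ^ k) _ ⟩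
  3 ^ k * (9 * ∑ k (λ m₁ → ∑₃² (G m₁))) ≡⟨ cong (3 ^ k *_) (∑-fibres a b independent λ x y → ∑₃² (h x y)) ⟩
  3 ^ k * (3 ^ k * ∑₃⁴ h)              ≡⟨ sym (*-assoc (3 ^ k) (3 ^ k) _) ⟩
  3 ^ k * 3 ^ k * ∑₃⁴ h                ∎
  where
  open ≡-Reasoning
  G : Word k → F₃ → F₃ → ℕ
  G m₁ = h (dot a m₁) (dot b m₁)
  H : Word k → Word k → ℕ
  H m₁ m₂ = G m₁ (dot a m₂) (dot b m₂)

-- Greedy choice of columns

unsplit : ∀ {k} → List (Word k) → Word k → Word k → ℕ
unsplit [] a b = 1
unsplit (g ∷ gs) a b = if does (splits? a b g) then 0 else unsplit gs a b

unsplit-++ : ∀ {k} (gs hs : List (Word k)) a b → unsplit (gs ++ hs) a b ≡ unsplit gs a b * unsplit hs a b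
unsplit-++ [] hs a b = sym (+-identityʳ _)
unsplit-++ (g ∷ gs) hs a b with does (splits? a b g)
... | true = refl
... | false = unsplit-++ gs hs a b

unsplit≡0 : ∀ {k} (gs : List (Word k)) a b → unsplit gs a b ≡ 0 → Any (Splits a b) gs
unsplit≡0 (g ∷ gs) a b eq = [ here , there ∘ unsplit≡0 gs a b ]′ (if≡0 (splits? a b g) eq)
  where
  if≡0 : ∀ {P : Set} (d : Dec P) {n} → (if does d then 0 else n) ≡ 0 → P ⊎ n ≡ 0
  if≡0 (yes p) _ = inj₁ p
  if≡0 (no _) eq = inj₂ eq

Pattern : Set
Pattern = List (F₃ × F₃)

columns : ∀ {k} → Pattern → Word k → Word k → List (Word k)
columns [] m₁ m₂ = []
columns ((s , t) ∷ c) m₁ m₂ = (s · m₁) ⊕ (t · m₂) ∷ columns c m₁ m₂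

misses : Pattern → F₃ → F₃ → F₃ → F₃ → ℕ
misses [] x y z w = 1
misses ((s , t) ∷ c) x y z w =
  if does (covers? 0F (s *₃ x +₃ t *₃ z) (s *₃ y +₃ t *₃ w)) then 0 else misses c x y z w

unsplit-columns : ∀ {k} c (m₁ m₂ a b : Word k) →
  unsplit (columns c m₁ m₂) a b ≡ misses c (dot a m₁) (dot b m₁) (dot a m₂) (dot b m₂)
unsplit-columns [] m₁ m₂ a b = refl
unsplit-columns ((s , t) ∷ c) m₁ m₂ a b =
  cong₃ (λ α β rest → if does (covers? 0F α β) then 0 else rest)
    (dot-column a) (dot-column b) (unsplit-columns c m₁ m₂ a b)
  where
  cong₃ : ∀ {A B C D : Set} (f : A → B → C → D) {x x′ y y′ z z′} →
    x ≡ x′ → y ≡ y′ → z ≡ z′ → f x y z ≡ f x′ y′ z′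
  cong₃ f refl refl refl = refl
  dot-column : ∀ u → dot u ((s · m₁) ⊕ (t · m₂)) ≡ s *₃ dot u m₁ +₃ t *₃ dot u m₂
  dot-column u = trans (dot-⊕ʳ u _ _) (cong₂ _+₃_ (dot-·ʳ s u m₁) (dot-·ʳ t u m₂))

failures : Pattern → ℕ
failures c = ∑₃⁴ (misses c)

Supported : ∀ {k} → (Word k → Word k → ℕ) → Set
Supported {k} w = ∀ (a b : Word k) → ¬ Independent a b → w a b ≡ 0

greedy-block : ∀ {k} (c : Pattern) (w : Word k → Word k → ℕ) → Supported w →
  ∃₂ λ m₁ m₂ → 81 * ∑² k (λ a b → w a b * unsplit (columns c m₁ m₂) a b) ≤ failures c * ∑² k w
greedy-block {k} c w supported = below-average (∑²-argmin k F)
  where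
  U : Word k → Word k → Word k → Word k → ℕ
  U a b m₁ m₂ = unsplit (columns c m₁ m₂) a b
  F : Word k → Word k → ℕ
  F m₁ m₂ = 81 * ∑² k (λ a b → w a b * U a b m₁ m₂)
  pointwise : ∀ a b → w a b * (81 * ∑² k (U a b)) ≡ w a b * (3 ^ k * 3 ^ k * failures c)
  pointwise a b with independent? a b
  ... | yes independent = cong (w a b *_) (trans (cong (81 *_) (∑²-cong k λ m₁ m₂ → unsplit-columns c m₁ m₂ a b))
                                                  (∑-blocks a b independent (misses c)))
  ... | no dependent rewrite supported a b dependent = refl
  total : ∑² k F ≡ 3 ^ k * 3 ^ k * (failures c * ∑² k w)
  total = begin
    ∑² k F                                               ≡⟨ ∑²-*ˡ k 81 _ ⟩
    81 * ∑² k (λ m₁ m₂ → ∑² k λ a b → w a b * U a b m₁ m₂)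
      ≡⟨ cong (81 *_) (∑²-comm k λ m₁ m₂ a b → w a b * U a b m₁ m₂) ⟩
    81 * ∑² k (λ a b → ∑² k λ m₁ m₂ → w a b * U a b m₁ m₂)
      ≡⟨ cong (81 *_) (∑²-cong k λ a b → ∑²-*ˡ k (w a b) (U a b)) ⟩
    81 * ∑² k (λ a b → w a b * ∑² k (U a b))             ≡⟨ sym (∑²-*ˡ k 81 _) ⟩
    ∑² k (λ a b → 81 * (w a b * ∑² k (U a b)))           ≡⟨ ∑²-cong k (λ a b → x∙yz≈y∙xz 81 (w a b) _) ⟩
    ∑² k (λ a b → w a b * (81 * ∑² k (U a b)))           ≡⟨ ∑²-cong k pointwise ⟩
    ∑² k (λ a b → w a b * (3 ^ k * 3 ^ k * failures c))  ≡⟨ ∑²-cong k (λ a b → *-comm (w a b) _) ⟩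
    ∑² k (λ a b → 3 ^ k * 3 ^ k * failures c * w a b)    ≡⟨ ∑²-*ˡ k (3 ^ k * 3 ^ k * failures c) w ⟩
    3 ^ k * 3 ^ k * failures c * ∑² k w                  ≡⟨ *-assoc (3 ^ k * 3 ^ k) (failures c) _ ⟩
    3 ^ k * 3 ^ k * (failures c * ∑² k w)                ∎
    where open ≡-Reasoning
  below-average : (∃₂ λ m₁ m₂ → 3 ^ k * 3 ^ k * F m₁ m₂ ≤ ∑² k F) → ∃₂ λ m₁ m₂ → F m₁ m₂ ≤ failures c * ∑² k w
  below-average (m₁ , m₂ , minimal) =
    m₁ , m₂ , *-cancelˡ-≤ (3 ^ k * 3 ^ k) {{m*n≢0 (3 ^ k) (3 ^ k) {{m^n≢0 3 k}} {{m^n≢0 3 k}}}}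
                          (≤-trans minimal (≤-reflexive total))

Layout : Set
Layout = List Pattern

width : Layout → ℕ
width ℓ = sum (List.map length ℓ)

failuresᴸ : Layout → ℕ
failuresᴸ ℓ = product (List.map failures ℓ)

length-columns : ∀ {k} c (m₁ m₂ : Word k) → length (columns c m₁ m₂) ≡ length c
length-columns [] m₁ m₂ = refl
length-columns (_ ∷ c) m₁ m₂ = cong suc (length-columns c m₁ m₂)

greedy : ∀ {k} (ℓ : Layout) (w : Word k → Word k → ℕ) → Supported w →
  ∃ λ gs → length gs ≡ width ℓ ×
           81 ^ length ℓ * ∑² k (λ a b → w a b * unsplit gs a b) ≤ failuresᴸ ℓ * ∑² k w
greedy {k} [] w supported = [] , refl ,
  ≤-reflexive (trans (*-identityˡ _) (trans (∑²-cong k λ a b → *-identityʳ (w a b)) (sym (*-identityˡ _))))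
greedy {k} (c ∷ ℓ) w supported = extend (greedy-block c w supported)
  where
  extend : (∃₂ λ m₁ m₂ → 81 * ∑² k (λ a b → w a b * unsplit (columns c m₁ m₂) a b) ≤ failures c * ∑² k w) →
    ∃ λ gs → length gs ≡ width (c ∷ ℓ) ×
             81 ^ length (c ∷ ℓ) * ∑² k (λ a b → w a b * unsplit gs a b) ≤ failuresᴸ (c ∷ ℓ) * ∑² k w
  extend (m₁ , m₂ , first) = rest (greedy ℓ w₁ supported₁)
    where
    gs₁ = columns c m₁ m₂
    w₁ : Word k → Word k → ℕ
    w₁ a b = w a b * unsplit gs₁ a b
    supported₁ : Supported w₁
    supported₁ a b dependent = cong (_* unsplit gs₁ a b) (supported a b dependent)
    rest : (∃ λ gs₂ → length gs₂ ≡ width ℓ ×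
                      81 ^ length ℓ * ∑² k (λ a b → w₁ a b * unsplit gs₂ a b) ≤ failuresᴸ ℓ * ∑² k w₁) →
      ∃ λ gs → length gs ≡ width (c ∷ ℓ) ×
               81 ^ length (c ∷ ℓ) * ∑² k (λ a b → w a b * unsplit gs a b) ≤ failuresᴸ (c ∷ ℓ) * ∑² k w
    rest (gs₂ , length₂ , second) = gs₁ ++ gs₂ ,
      trans (length-++ gs₁) (cong₂ _+_ (length-columns c m₁ m₂) length₂) , (begin
      81 * 81 ^ length ℓ * ∑² k (λ a b → w a b * unsplit (gs₁ ++ gs₂) a b)
        ≡⟨ cong (81 * 81 ^ length ℓ *_) (∑²-cong k λ a b → trans (cong (w a b *_) (unsplit-++ gs₁ gs₂ a b))
                                                                (sym (*-assoc (w a b) _ _))) ⟩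
      81 * 81 ^ length ℓ * ∑² k (λ a b → w₁ a b * unsplit gs₂ a b)
        ≡⟨ *-assoc 81 (81 ^ length ℓ) _ ⟩
      81 * (81 ^ length ℓ * ∑² k (λ a b → w₁ a b * unsplit gs₂ a b))
        ≤⟨ *-monoʳ-≤ 81 second ⟩
      81 * (failuresᴸ ℓ * ∑² k w₁)
        ≡⟨ x∙yz≈y∙xz 81 (failuresᴸ ℓ) _ ⟩
      failuresᴸ ℓ * (81 * ∑² k w₁)
        ≤⟨ *-monoʳ-≤ (failuresᴸ ℓ) first ⟩
      failuresᴸ ℓ * (failures c * ∑² k w)
        ≡⟨ trans (x∙yz≈y∙xz (failuresᴸ ℓ) (failures c) _) (sym (*-assoc (failures c) (failuresᴸ ℓ) _)) ⟩
      failures c * failuresᴸ ℓ * ∑² k w ∎)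
      where open ≤-Reasoning

data Normalized : ∀ {k} → Word k → Set where
  leading-one  : ∀ {k} {v : Word k} → Normalized (1F ∷ v)
  leading-zero : ∀ {k} {v : Word k} → Normalized v → Normalized (0F ∷ v)

normalized? : ∀ {k} (v : Word k) → Dec (Normalized v)
normalized? [] = no λ ()
normalized? (0F ∷ v) = map′ leading-zero (λ { (leading-zero n) → n }) (normalized? v)
normalized? (1F ∷ v) = yes leading-one
normalized? (2F ∷ v) = no λ ()

≢0ʷ⇒normalized : ∀ {k} (a : Word k) → a ≢ 0ʷ → Normalized a ⊎ Normalized (2F · a)
≢0ʷ⇒normalized [] []≢0 = contradiction refl []≢0
≢0ʷ⇒normalized (0F ∷ a) a≢0 =
  Sum.map leading-zero leading-zero (≢0ʷ⇒normalized a λ a≡0 → a≢0 (cong (0F ∷_) a≡0))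
≢0ʷ⇒normalized (1F ∷ a) _ = inj₁ leading-one
≢0ʷ⇒normalized (2F ∷ a) _ = inj₂ leading-one

𝟙 : ∀ {P : Set} → Dec P → ℕ
𝟙 d = if does d then 1 else 0

#normalized : ℕ → ℕ
#normalized k = ∑ k λ v → 𝟙 (normalized? v)

#normalized-count : ∀ k → 2 * #normalized k + 1 ≡ 3 ^ k
#normalized-count zero = refl
#normalized-count (suc k) = begin
  2 * (N + ∑ k (λ _ → 1) + ∑ k (λ _ → 0)) + 1  ≡⟨ cong₂ (λ o z → 2 * (N + o + z) + 1) (∑-const k 1) (∑-const k 0) ⟩
  2 * (N + 3 ^ k * 1 + 3 ^ k * 0) + 1          ≡⟨ cong (λ t → 2 * (N + t * 1 + t * 0) + 1) (sym (#normalized-count k)) ⟩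
  2 * (N + (2 * N + 1) * 1 + (2 * N + 1) * 0) + 1 ≡⟨ triple N ⟩
  3 * (2 * N + 1)                              ≡⟨ cong (3 *_) (#normalized-count k) ⟩
  3 ^ suc k                                    ∎
  where
  open ≡-Reasoning
  N = #normalized k
  triple : ∀ n → 2 * (n + (2 * n + 1) * 1 + (2 * n + 1) * 0) + 1 ≡ 3 * (2 * n + 1)
  triple = solve-∀

𝟙-yes : ∀ {P : Set} (d : Dec P) → P → 𝟙 d ≡ 1
𝟙-yes (yes _) _ = refl
𝟙-yes (no ¬p) p = contradiction p ¬p

𝟙-no : ∀ {P : Set} (d : Dec P) → ¬ P → 𝟙 d ≡ 0
𝟙-no (yes p) ¬p = contradiction p ¬p
𝟙-no (no _) _ = refl

𝟙≤1 : ∀ {P : Set} (d : Dec P) → 𝟙 d ≤ 1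
𝟙≤1 (yes _) = ≤-refl
𝟙≤1 (no _) = z≤n

-- With T = 2n + 1 the hypothesis reads 2 F T n + F T ≤ 2 M.
first-moment-bound : ∀ n F M → 0 < M → (2 * n + 1) * (2 * n + 1) * F ≤ 2 * M → F * ((2 * n + 1) * n) < M
first-moment-bound n zero M 0<M _ = 0<M
first-moment-bound n F@(suc f) M _ hyp = *-cancelˡ-< 2 _ _ (begin-strict
  2 * (F * ((2 * n + 1) * n))                                  <⟨ m<m+n _ (*-mono-≤ {1} {F} {1} (s≤s z≤n) (m≤n+m 1 (2 * n))) ⟩
  2 * (F * ((2 * n + 1) * n)) + F * (2 * n + 1)              ≡⟨ expand n F ⟩
  (2 * n + 1) * (2 * n + 1) * F                                ≤⟨ hyp ⟩
  2 * M                                                        ∎)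
  where
  open ≤-Reasoning
  expand : ∀ n F → 2 * (F * ((2 * n + 1) * n)) + F * (2 * n + 1) ≡ (2 * n + 1) * (2 * n + 1) * F
  expand = solve-∀

-- The pairs still to be split, one from each class {(a, b), (2a, 2b)}.
candidates : ∀ {k} → Word k → Word k → ℕ
candidates a b = 𝟙 (normalized? a) * 𝟙 (independent? a b)

candidates-supported : ∀ {k} → Supported (candidates {k})
candidates-supported a b dependent =
  trans (cong (𝟙 (normalized? a) *_) (𝟙-no (independent? a b) dependent)) (*-zeroʳ (𝟙 (normalized? a)))

∑²-candidates : ∀ k → ∑² k candidates ≤ 3 ^ k * #normalized k
∑²-candidates k = begin
  ∑² k candidates                          ≤⟨ ∑-mono-≤ k (λ a → ∑-mono-≤ k λ b →
                                                ≤-trans (*-monoʳ-≤ (𝟙 (normalized? a)) (𝟙≤1 (independent? a b)))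
                                                        (≤-reflexive (*-identityʳ _))) ⟩
  ∑ k (λ a → ∑ k λ _ → 𝟙 (normalized? a))  ≡⟨ ∑-cong k (λ a → ∑-const k (𝟙 (normalized? a))) ⟩
  ∑ k (λ a → 3 ^ k * 𝟙 (normalized? a))    ≡⟨ ∑-*ˡ k (3 ^ k) _ ⟩
  3 ^ k * #normalized k                    ∎
  where open ≤-Reasoning

all-candidates-split⇒separating : ∀ {k} (gs : List (Word k)) →
  (∀ a b → candidates a b * unsplit gs a b ≡ 0) → Separating gs
all-candidates-split⇒separating gs none-left a b independent =
  [ (λ normalized → separates a b normalized independent)
  , (λ normalized → Any.map (Splits-·2⁻ a b) (separates (2F · a) (2F · b) normalized (independent-·2 a b independent)))
  ]′ (≢0ʷ⇒normalized a (independent⇒≢0ʷ a b independent))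
  where
  separates : ∀ a b → Normalized a → Independent a b → Any (Splits a b) gs
  separates a b normalized independent = unsplit≡0 gs a b (begin
    unsplit gs a b                ≡⟨ sym (*-identityˡ _) ⟩
    1 * 1 * unsplit gs a b        ≡⟨ cong₂ (λ p q → p * q * unsplit gs a b) (sym (𝟙-yes (normalized? a) normalized))
                                                                           (sym (𝟙-yes (independent? a b) independent)) ⟩
    candidates a b * unsplit gs a b ≡⟨ none-left a b ⟩
    0                             ∎)
    where open ≡-Reasoning

separating-columns : ∀ k (ℓ : Layout) → 3 ^ k * 3 ^ k * failuresᴸ ℓ ≤ 2 * 81 ^ length ℓ →
  ∃ λ gs → length gs ≡ width ℓ × Separating gs
separating-columns k ℓ hyp = select (greedy ℓ candidates candidates-supported)
  where
  few-failures : failuresᴸ ℓ * (3 ^ k * #normalized k) < 81 ^ length ℓ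
  few-failures = subst (λ t → failuresᴸ ℓ * (t * #normalized k) < 81 ^ length ℓ) (#normalized-count k)
    (first-moment-bound (#normalized k) (failuresᴸ ℓ) (81 ^ length ℓ) (m^n>0 81 (length ℓ))
      (subst (λ t → t * t * failuresᴸ ℓ ≤ 2 * 81 ^ length ℓ) (sym (#normalized-count k)) hyp))
  select : (∃ λ gs → length gs ≡ width ℓ ×
             81 ^ length ℓ * ∑² k (λ a b → candidates a b * unsplit gs a b) ≤ failuresᴸ ℓ * ∑² k candidates) →
    ∃ λ gs → length gs ≡ width ℓ × Separating gs
  select (gs , length≡ , bound) = gs , length≡ ,
    all-candidates-split⇒separating gs λ a b → ∑≡0 k _ (∑≡0 k _ remaining≡0 a) b
    where
    remaining≡0 : ∑² k (λ a b → candidates a b * unsplit gs a b) ≡ 0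
    remaining≡0 = n<1⇒n≡0 (*-cancelˡ-< (81 ^ length ℓ) _ _ (begin-strict
      81 ^ length ℓ * ∑² k (λ a b → candidates a b * unsplit gs a b)  ≤⟨ bound ⟩
      failuresᴸ ℓ * ∑² k candidates                                   ≤⟨ *-monoʳ-≤ (failuresᴸ ℓ) (∑²-candidates k) ⟩
      failuresᴸ ℓ * (3 ^ k * #normalized k)                           <⟨ few-failures ⟩
      81 ^ length ℓ                                                   ≡⟨ sym (*-identityʳ _) ⟩
      81 ^ length ℓ * 1                                               ∎))
      where open ≤-Reasoning

-- Choice of parameters

-- The four points of the projective line over F₃.
tetracode : Pattern
tetracode = (1F , 0F) ∷ (0F , 1F) ∷ (1F , 1F) ∷ (1F , 2F) ∷ []

single : Pattern
single = (1F , 0F) ∷ []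

failures-tetracode : failures tetracode ≡ 25
failures-tetracode = refl

failures-single : failures single ≡ 63
failures-single = refl

layout : ℕ → ℕ → Layout
layout N r = List.replicate N tetracode ++ List.replicate r single

width-layout : ∀ N r → width (layout N r) ≡ N * 4 + r
width-layout zero zero = refl
width-layout zero (suc r) = cong suc (width-layout zero r)
width-layout (suc N) r = cong (4 +_) (width-layout N r)

length-layout : ∀ N r → length (layout N r) ≡ N + r
length-layout zero zero = refl
length-layout zero (suc r) = cong suc (length-layout zero r)
length-layout (suc N) r = cong suc (length-layout N r)

failuresᴸ-layout : ∀ N r → failuresᴸ (layout N r) ≡ 25 ^ N * 63 ^ r
failuresᴸ-layout zero r = trans (singles r) (sym (*-identityˡ (63 ^ r)))
  where
  singles : ∀ r → failuresᴸ (List.replicate r single) ≡ 63 ^ r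
  singles zero = refl
  singles (suc r) = cong₂ _*_ failures-single (singles r)
failuresᴸ-layout (suc N) r =
  trans (cong₂ _*_ failures-tetracode (failuresᴸ-layout N r)) (sym (*-assoc 25 (25 ^ N) (63 ^ r)))

TrifferentCodeOfSize : ℕ → ℕ → Set
TrifferentCodeOfSize n s = ∃ λ (C : List (Word n)) → IsLinear C × IsTrifferent C × length C ≡ s

LargeTrifferentCode : ℕ → Set
LargeTrifferentCode n = ∃ λ (C : List (Word n)) → IsLinear C × IsTrifferent C × (9 ^ n ≤ (3 * length C) ^ 4 * 5 ^ n)

linear-trifferent-code : ∀ k (ℓ : Layout) → 2 ≤ k → 3 ^ k * 3 ^ k * failuresᴸ ℓ ≤ 2 * 81 ^ length ℓ →
  TrifferentCodeOfSize (width ℓ) (3 ^ k)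
linear-trifferent-code k ℓ 2≤k hyp = build (separating-columns k ℓ hyp)
  where
  build : (∃ λ gs → length gs ≡ width ℓ × Separating gs) → TrifferentCodeOfSize (width ℓ) (3 ^ k)
  build (gs , length≡ , separating) = subst (λ n → TrifferentCodeOfSize n (3 ^ k)) length≡
    (codeOf gs , codeOf-linear , codeOf-trifferent , length-codeOf gs)
    where open SeparatingCode 2≤k gs separating

n<b^n : ∀ b → 1 < b → ∀ n → n < b ^ n
n<b^n b 1<b zero = s≤s z≤n
n<b^n b 1<b (suc n) = begin-strict
  suc n            ≤⟨ n<b^n b 1<b n ⟩
  b ^ n            <⟨ m<m+n (b ^ n) (m^n>0 b n) ⟩
  b ^ n + b ^ n    ≡⟨ cong (b ^ n +_) (sym (+-identityʳ (b ^ n))) ⟩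
  2 * b ^ n        ≤⟨ *-monoˡ-≤ (b ^ n) 1<b ⟩
  b ^ suc n        ∎
  where
  open ≤-Reasoning
  instance
    b≢0 : NonZero b
    b≢0 = >-nonZero (<-trans (s≤s z≤n) 1<b)

power-bracket : ∀ b A B → 1 < b → 0 < A → A ≤ B → ∃ λ j → b ^ j * A ≤ B × B < b ^ suc j * A
power-bracket b A B 1<b 0<A A≤B =
  search B A 0<A A≤B (<-≤-trans (n<b^n b 1<b B) (m≤m*n (b ^ B) A {{>-nonZero 0<A}}))
  where
  rescale : ∀ j A → b ^ j * (b * A) ≡ b ^ suc j * A
  rescale j A = regroup (b ^ j) b A
    where
    regroup : ∀ x b A → x * (b * A) ≡ b * x * A
    regroup = solve-∀
  shift : ∀ {A} → (∃ λ j → b ^ j * (b * A) ≤ B × B < b ^ suc j * (b * A)) →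
    ∃ λ j → b ^ j * A ≤ B × B < b ^ suc j * A
  shift {A} (j , lower , upper) = suc j , subst (_≤ B) (rescale j A) lower , subst (B <_) (rescale (suc j) A) upper
  search : ∀ fuel A → 0 < A → A ≤ B → B < b ^ fuel * A → ∃ λ j → b ^ j * A ≤ B × B < b ^ suc j * A
  search zero A _ A≤B B<A = contradiction A≤B (<⇒≱ (subst (B <_) (*-identityˡ A) B<A))
  search (suc fuel) A 0<A A≤B B<bᶠA with B <? b * A
  ... | yes B<bA = 0 , ≤-trans (≤-reflexive (*-identityˡ A)) A≤B , subst (B <_) (cong (_* A) (sym (*-identityʳ b))) B<bA
  ... | no B≮bA = shift (search fuel (b * A) (*-mono-≤ {1} {b} {1} {A} (<⇒≤ 1<b) 0<A) (≮⇒≥ B≮bA)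
                                (subst (B <_) (sym (rescale fuel A)) B<bᶠA))

3^*3^≡9^ : ∀ k → 3 ^ k * 3 ^ k ≡ 9 ^ k
3^*3^≡9^ zero = refl
3^*3^≡9^ (suc k) = trans (regroup (3 ^ k)) (cong (9 *_) (3^*3^≡9^ k))
  where
  regroup : ∀ x → 3 * x * (3 * x) ≡ 9 * (x * x)
  regroup = solve-∀

dimension-two-fits : ∀ N r → 4 ≤ N → 81 * (25 ^ N * 63 ^ r) ≤ 2 * 81 ^ (N + r)
dimension-two-fits N r 4≤N = begin
  81 * (25 ^ N * 63 ^ r)      ≡⟨ sym (*-assoc 81 (25 ^ N) (63 ^ r)) ⟩
  81 * 25 ^ N * 63 ^ r        ≤⟨ *-mono-≤ (tetracodes (≤⇒≤′ 4≤N)) (^-monoˡ-≤ r (≤ᵇ⇒≤ 63 81 _)) ⟩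
  2 * 81 ^ N * 81 ^ r         ≡⟨ *-assoc 2 (81 ^ N) (81 ^ r) ⟩
  2 * (81 ^ N * 81 ^ r)       ≡⟨ cong (2 *_) (sym (^-distribˡ-+-* 81 N r)) ⟩
  2 * 81 ^ (N + r)            ∎
  where
  open ≤-Reasoning
  tetracodes : ∀ {N} → 4 ≤′ N → 81 * 25 ^ N ≤ 2 * 81 ^ N
  tetracodes ≤′-refl = ≤ᵇ⇒≤ _ _ _
  tetracodes {suc N} (≤′-step 4≤′N) = begin
    81 * (25 * 25 ^ N)        ≡⟨ x∙yz≈y∙xz 81 25 (25 ^ N) ⟩
    25 * (81 * 25 ^ N)        ≤⟨ *-mono-≤ (≤ᵇ⇒≤ 25 81 _) (tetracodes 4≤′N) ⟩
    81 * (2 * 81 ^ N)         ≡⟨ x∙yz≈y∙xz 81 2 (81 ^ N) ⟩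
    2 * (81 * 81 ^ N)         ∎

-- Each tetracode block contributes the same factor 9⁴ · 25² = 81² · 5⁴ to both sides.
remainder-bound : ∀ N r → r < 4 →
  9 ^ (N * 4 + r) * ((25 ^ N * 63 ^ r) * (25 ^ N * 63 ^ r)) ≤ 4 * (81 ^ (N + r) * 81 ^ (N + r)) * 5 ^ (N * 4 + r)
remainder-bound zero 0 _ = ≤ᵇ⇒≤ _ _ _
remainder-bound zero 1 _ = ≤ᵇ⇒≤ _ _ _
remainder-bound zero 2 _ = ≤ᵇ⇒≤ _ _ _
remainder-bound zero 3 _ = ≤ᵇ⇒≤ _ _ _
remainder-bound zero (suc (suc (suc (suc r)))) (s≤s (s≤s (s≤s (s≤s ()))))
remainder-bound (suc N) r r<4 = begin
  9 ^ (4 + (N * 4 + r)) * ((25 * 25 ^ N * 63 ^ r) * (25 * 25 ^ N * 63 ^ r))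
    ≡⟨ left 9 25 (9 ^ (N * 4 + r)) (25 ^ N) (63 ^ r) ⟩
  9 * 9 * 9 * 9 * (25 * 25) * (9 ^ (N * 4 + r) * ((25 ^ N * 63 ^ r) * (25 ^ N * 63 ^ r)))
    ≤⟨ *-monoʳ-≤ (9 * 9 * 9 * 9 * (25 * 25)) (remainder-bound N r r<4) ⟩
  81 * 81 * (5 * 5 * 5 * 5) * (4 * (81 ^ (N + r) * 81 ^ (N + r)) * 5 ^ (N * 4 + r))
    ≡⟨ right 81 5 (81 ^ (N + r)) (5 ^ (N * 4 + r)) ⟩
  4 * (81 ^ (suc N + r) * 81 ^ (suc N + r)) * 5 ^ (4 + (N * 4 + r)) ∎
  where
  open ≤-Reasoning
  left : ∀ a b x y z →
    a * (a * (a * (a * x))) * ((b * y * z) * (b * y * z)) ≡ a * a * a * a * (b * b) * (x * ((y * z) * (y * z)))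
  left = solve-∀
  right : ∀ c d m f →
    c * c * (d * d * d * d) * (4 * (m * m) * f) ≡ 4 * ((c * m) * (c * m)) * (d * (d * (d * (d * f))))
  right = solve-∀

size-bound : ∀ N r k → r < 4 → 2 * 81 ^ (N + r) < 9 ^ suc k * (25 ^ N * 63 ^ r) →
  9 ^ (N * 4 + r) ≤ (3 * 3 ^ k) ^ 4 * 5 ^ (N * 4 + r)
size-bound N r k r<4 upper = <⇒≤ (subst (λ t → 9 ^ n < t * 5 ^ n) X*X≡ (*-cancelʳ-< (P * P) _ _ (begin-strict
  9 ^ n * (P * P)                  ≤⟨ remainder-bound N r r<4 ⟩
  4 * (M * M) * 5 ^ n              ≡⟨ cong (_* 5 ^ n) (square-double M) ⟩
  (2 * M) * (2 * M) * 5 ^ n        <⟨ *-monoˡ-< (5 ^ n) {{m^n≢0 5 n}} (*-mono-< upper upper) ⟩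
  (X * P) * (X * P) * 5 ^ n        ≡⟨ regroup X P (5 ^ n) ⟩
  X * X * 5 ^ n * (P * P)          ∎)))
  where
  open ≤-Reasoning
  n = N * 4 + r
  P = 25 ^ N * 63 ^ r
  M = 81 ^ (N + r)
  X = 9 ^ suc k
  square-double : ∀ m → 4 * (m * m) ≡ (2 * m) * (2 * m)
  square-double = solve-∀
  regroup : ∀ x p f → (x * p) * (x * p) * f ≡ x * x * f * (p * p)
  regroup = solve-∀
  X*X≡ : X * X ≡ (3 * 3 ^ k) ^ 4
  X*X≡ = trans (cong (λ t → t * t) (sym (3^*3^≡9^ (suc k)))) (fourth (3 * 3 ^ k))
    where
    fourth : ∀ t → (t * t) * (t * t) ≡ t * (t * (t * (t * 1)))
    fourth = solve-∀

large-trifferent-code : ∀ N r → 4 ≤ N → r < 4 → LargeTrifferentCode (N * 4 + r)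
large-trifferent-code N r 4≤N r<4 =
  choose (power-bracket 9 (81 * P) (2 * 81 ^ (N + r)) (s≤s (s≤s z≤n)) (*-mono-≤ {1} {81} (s≤s z≤n) P>0)
                        (dimension-two-fits N r 4≤N))
  where
  P = 25 ^ N * 63 ^ r
  P>0 : 0 < P
  P>0 = *-mono-≤ (m^n>0 25 N) (m^n>0 63 r)
  regroup : ∀ x p → 9 * (9 * x) * p ≡ x * (81 * p)
  regroup = solve-∀
  choose : (∃ λ j → 9 ^ j * (81 * P) ≤ 2 * 81 ^ (N + r) × 2 * 81 ^ (N + r) < 9 ^ suc j * (81 * P)) →
    LargeTrifferentCode (N * 4 + r)
  choose (j , lower , upper) = sized (subst (λ n → TrifferentCodeOfSize n (3 ^ k)) (width-layout N r)
                                            (linear-trifferent-code k (layout N r) (s≤s (s≤s z≤n)) admissible))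
    where
    k = 2 + j
    admissible : 3 ^ k * 3 ^ k * failuresᴸ (layout N r) ≤ 2 * 81 ^ length (layout N r)
    admissible = subst₂ _≤_ (sym (trans (cong₂ _*_ (3^*3^≡9^ k) (failuresᴸ-layout N r)) (regroup (9 ^ j) P)))
                            (cong (λ l → 2 * 81 ^ l) (sym (length-layout N r))) lower
    sized : TrifferentCodeOfSize (N * 4 + r) (3 ^ k) → LargeTrifferentCode (N * 4 + r)
    sized (C , linear , trifferent , size) = C , linear , trifferent ,
      subst (λ s → 9 ^ (N * 4 + r) ≤ (3 * s) ^ 4 * 5 ^ (N * 4 + r)) (sym size)
        (size-bound N r k r<4 (subst (2 * 81 ^ (N + r) <_) (sym (regroup (9 ^ suc j) P)) upper))

theorem1p6 : ∃ λ (N : ℕ) → ∀ (n : ℕ) → N ≤ n →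
    ∃ λ (C : List (Word n)) →
      IsLinear C × IsTrifferent C × (9 ^ n ≤ (3 * length C) ^ 4 * 5 ^ n)
theorem1p6 = 16 , λ n 16≤n →
  subst LargeTrifferentCode (sym (trans (m≡m%n+[m/n]*n n 4) (+-comm (n % 4) (n / 4 * 4))))
        (large-trifferent-code (n / 4) (n % 4) (/-monoˡ-≤ 4 16≤n) (m%n<n n 4))
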